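{- We have $\delta_j=n-h$. Moreover, $\delta_j$ is even.
   Context: Fix integers $n,m\geq 1$ and the type $C_n$ alphabet $\overline{n}<\cdots<\overline{1}<1<\cdots<n$. A column of type $C_n$ is a subset $c$ of this alphabet (written increasingly from top to bottom), of height $|c|$. For $i=1,\ldots,n$ let $N_i(c)=|\{x\in c \mid x\leq \overline{i}\text{ or } x\geq i\}|$; the column $c$ is called $n$-admissible if $N_i(c)\leq n-i+1$ for all $i=1,\ldots,n$. The contraction of a column is the type $C_n$ plactic relation (Lecouvey) which removes a certain pair $(\overline{k},k)$ of entries from the column; it is a $C_n$-crystal isomorphism, and its inverse is called dilatation. Let $b=c_1\otimes\cdots\otimes c_m$ be a tensor product of $m$ columns of type $C_n$, all of height $n$. Fix $j\in\{1,\ldots,m\}$. Let $d_j$ be the type $C_n$ column obtained by dilating $c_j$ recursively as much as possible; $d_j$ can then be contracted a certain number of times, denoted $\delta_j$, until it becomes $n$-admissible. Let $h$ denote the height of the $n$-admissible column obtained from $c_j$ by applying recursively as many contractions as possible. -}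

module Defs where

open import Data.Nat using (ℕ; zero; suc; _+_; _∸_; _≤_; _<_)
open import Data.Integer as ℤ using (ℤ; +_; -_)
import Data.Integer.Properties as ℤP
open import Data.List using (List; []; _∷_; _++_; filter; length)
open import Data.List.Relation.Unary.All using (All)
open import Data.List.Relation.Unary.Linked using (Linked)
open import Data.List.Membership.Propositional using (_∈_)
open import Data.Product using (_×_)
open import Data.Sum using (_⊎_)
open import Relation.Nullary using (¬_)
open import Relation.Nullary.Decidable using (_⊎-dec_; ¬?)
open import Relation.Binary.PropositionalEquality using (_≡_; _≢_)
import Data.Nat as ℕ

-- Letters of the type C_n alphabet  n̄ < ... < 1̄ < 1 < ... < n  are encoded
-- as integers:  k ↦ + k  and  k̄ ↦ - (+ k)  (1 ≤ k ≤ n).  The integer order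
-- then coincides with the order of the alphabet.
Letter : Set
Letter = ℤ

IsLetter : ℕ → Letter → Set
IsLetter n x = (x ≢ + 0) × (- (+ n) ℤ.≤ x) × (x ℤ.≤ + n)

IsColumn : ℕ → List Letter → Set
IsColumn n c = Linked ℤ._<_ c × All (IsLetter n) c

N : ℕ → List Letter → ℕ
N i c = length (filter (λ x → (x ℤ.≤? - (+ i)) ⊎-dec ((+ i) ℤ.≤? x)) c)

Admissible : ℕ → List Letter → Set
Admissible n c = ∀ i → 1 ≤ i → i ≤ n → N i c ≤ n ∸ i + 1

-- A column word all of whose strict factors are n-admissible, but which is
-- not itself n-admissible (domain of Lecouvey's contraction relation).
MinNonAdmissible : ℕ → List Letter → Set
MinNonAdmissible n v =
  ¬ Admissible n v ×
  (∀ (a x b : List Letter) → v ≡ a ++ x ++ b → (a ≢ [] ⊎ b ≢ []) → Admissible n x)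

PairIn : ℕ → List Letter → Set
PairIn i v = (- (+ i) ∈ v) × ((+ i) ∈ v)

-- Lecouvey's rule (translated to the present ordering of the alphabet):
-- i is the largest index in 1..n such that the pair (ī,i) occurs in v
-- and N_i(v) = n - i + 2.
ContractionIndex : ℕ → List Letter → ℕ → Set
ContractionIndex n v i =
  1 ≤ i × i ≤ n × PairIn i v × N i v ≡ n ∸ i + 2 ×
  (∀ j → i < j → j ≤ n → PairIn j v → N j v ≢ n ∸ j + 2)

erasePair : ℕ → List Letter → List Letter
erasePair i v = filter (λ x → ¬? (ℤ.∣ x ∣ ℕ.≟ i)) v

-- One application of the contraction relation to a factor of the column c,
-- producing c'.  (Its inverse is one dilatation c' ↦ c.)
data Contraction (n : ℕ) (c c' : List Letter) : Set where
  contract : (u v w : List Letter) (i : ℕ) →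
             IsColumn n c →
             c ≡ u ++ v ++ w →
             MinNonAdmissible n v →
             ContractionIndex n v i →
             c' ≡ u ++ erasePair i v ++ w →
             Contraction n c c'

data Contractions (n : ℕ) : ℕ → List Letter → List Letter → Set where
  done : ∀ {c} → Contractions n 0 c c
  step : ∀ {k c c' c''} → Contraction n c c' → Contractions n k c' c'' →
         Contractions n (suc k) c c''

-- d is obtained from c by dilating recursively as much as possible:
-- c is obtained from d by contractions, and d admits no further dilatation.
MaximalDilatation : ℕ → List Letter → List Letter → Set
MaximalDilatation n c d =
  Data.Product.∃ (λ k → Contractions n k d c) × (∀ e → ¬ Contraction n e d)

{-# OPTIONS --safe #-}
-- For a word c put level c j = N_j(c) + j and let peak n c be the maximum of n + 1 and of the
-- levels at 1 ≤ j ≤ n, so that c is n-admissible exactly when its peak is n + 1.  A contraction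
-- u v w ↦ u v′ w lowers the peak by exactly one: the letters of u and w have absolute value
-- greater than the contraction index i, the factor v has maximal level n + 2, attained at i, and
-- v′ = v without (ī, i) has maximal level n + 1, attained at i + 1.  Hence every chain of
-- contractions from c to an admissible column has length peak n c − (n + 1).
-- A column d admitting no dilatation has peak |d| + 1, its level at j = 1: otherwise, at the
-- first index t + 1 where the level reaches the peak, d has no letter ±t, and adding the pair
-- (t̄, t) to d gives a column whose contraction is d (the contracted factor is cut out of it by
-- removing end letters of largest absolute value).  So if d_j contracts to c_j in k steps, then
-- |d_j| = n + 2k, δ_j = peak n d_j − (n + 1) = 2k, and c_j needs k contractions, whence
-- h = n − 2k = n − δ_j.
module Submission where

open import Defs
open import Data.Nat as ℕ using (ℕ; zero; suc; _+_; _∸_; _≤_; _<_; _⊔_; z≤n; s≤s)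
open import Data.Nat.Properties
open import Data.Nat.Divisibility using (_∣_; divides)
open import Data.Nat.Tactic.RingSolver using (solve-∀)
open import Data.Integer as ℤ using (ℤ; -[1+_]; ∣_∣)
import Data.Integer.Properties as ℤₚ
open import Data.List using (List; []; _∷_; [_]; _++_; _∷ʳ_; filter; length; applyUpTo; initLast; _∷ʳ′_)
open import Data.List.Properties
  using (filter-accept; filter-reject; filter-++; filter-all; filter-some; length-filter; length-++; ++-assoc; ++-identityʳ)
open import Data.List.Relation.Unary.All as All using (All; []; _∷_)
import Data.List.Relation.Unary.All.Properties as All
open import Data.List.Relation.Unary.AllPairs as AllPairs using (AllPairs; []; _∷_)
import Data.List.Relation.Unary.AllPairs.Properties as AllPairs
open import Data.List.Relation.Unary.Any as Any using (Any; here; there)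
open import Data.List.Relation.Unary.Linked.Properties using (Linked⇒AllPairs; AllPairs⇒Linked)
open import Data.List.Membership.Propositional using (_∈_)
open import Data.List.Membership.Propositional.Properties
  using (∈-++⁺ˡ; ∈-++⁺ʳ; ∈-++⁻; ∈-filter⁺; ∈-filter⁻; ∈-applyUpTo⁻)
open import Data.List.Relation.Binary.Permutation.Propositional using (_↭_; prep; swap; ↭-refl; ↭-sym; ↭-trans)
open import Data.List.Relation.Binary.Permutation.Propositional.Properties using (filter-↭; ↭-length; All-resp-↭; ∈-resp-↭)
open import Data.List.Extrema.Nat using (max; ⊥≤max; xs≤max; max≤v⁺; argmax-sel)
open import Data.Product using (_×_; _,_; proj₁; proj₂; ∃-syntax)
open import Data.Sum using (_⊎_; inj₁; inj₂)
open import Data.Empty using (⊥-elim)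
open import Function using (_∘_; id)
open import Relation.Nullary using (¬_; yes; no; contradiction)
open import Relation.Nullary.Decidable using (_⊎-dec_; ¬?)
open import Relation.Binary using (tri<; tri≈; tri>)
open import Relation.Unary using (Decidable)
open import Relation.Binary.PropositionalEquality
  using (_≡_; _≢_; refl; sym; trans; cong; cong₂; subst; subst₂; module ≡-Reasoning)

-- Counting letters by absolute value

Increasing : List ℤ → Set
Increasing = AllPairs ℤ._<_

Counted : ℕ → ℤ → Set
Counted i x = (x ℤ.≤ ℤ.- (ℤ.+ i)) ⊎ (ℤ.+ i ℤ.≤ x)

counted? : (i : ℕ) → Decidable (Counted i)
counted? i x = (x ℤ.≤? ℤ.- (ℤ.+ i)) ⊎-dec (ℤ.+ i ℤ.≤? x)

counted⇒i≤∣x∣ : ∀ {i} x → Counted i x → i ≤ ∣ x ∣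
counted⇒i≤∣x∣ {zero}  _         _                  = z≤n
counted⇒i≤∣x∣ {suc _} (ℤ.+ _)   (inj₂ (ℤ.+≤+ i≤m)) = i≤m
counted⇒i≤∣x∣ {suc _} -[1+ _ ]  (inj₁ (ℤ.-≤- i≤m)) = s≤s i≤m

i≤∣x∣⇒counted : ∀ {i} x → i ≤ ∣ x ∣ → Counted i x
i≤∣x∣⇒counted {zero}  (ℤ.+ _)  _         = inj₂ (ℤ.+≤+ z≤n)
i≤∣x∣⇒counted {zero}  -[1+ _ ] _         = inj₁ ℤ.-≤+
i≤∣x∣⇒counted {suc _} (ℤ.+ _)  i≤m       = inj₂ (ℤ.+≤+ i≤m)
i≤∣x∣⇒counted {suc _} -[1+ _ ] (s≤s i≤m) = inj₁ (ℤ.-≤- i≤m)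

module _ {i : ℕ} where

  N-accept : ∀ x c → i ≤ ∣ x ∣ → N i (x ∷ c) ≡ suc (N i c)
  N-accept x c i≤x = cong length (filter-accept (counted? i) {x} {c} (i≤∣x∣⇒counted _ i≤x))

  N-reject : ∀ x c → ∣ x ∣ < i → N i (x ∷ c) ≡ N i c
  N-reject x c x<i = cong length (filter-reject (counted? i) {x} {c} (<⇒≱ x<i ∘ counted⇒i≤∣x∣ _))

  N-++ : ∀ a b → N i (a ++ b) ≡ N i a + N i b
  N-++ a b = trans (cong length (filter-++ (counted? i) a b)) (length-++ (filter (counted? i) a))

  N-all : ∀ {c} → All (λ x → i ≤ ∣ x ∣) c → N i c ≡ length c
  N-all {c} all = cong length (filter-all (counted? i) {c} (All.map (i≤∣x∣⇒counted _) all))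

  N-none : ∀ {c} → All (λ x → ∣ x ∣ < i) c → N i c ≡ 0
  N-none {[]}    []           = refl
  N-none {x ∷ c} (x<i ∷ none) = trans (N-reject x c x<i) (N-none none)

  N-some : ∀ {c} → Any (λ x → i ≤ ∣ x ∣) c → 0 < N i c
  N-some some = filter-some (counted? i) (Any.map (i≤∣x∣⇒counted _) some)

  N≤length : ∀ c → N i c ≤ length c
  N≤length = length-filter (counted? i)

  N-resp-↭ : ∀ {c c'} → c ↭ c' → N i c ≡ N i c'
  N-resp-↭ c↭c' = ↭-length (filter-↭ (counted? i) c↭c')

N-zero : ∀ c → N 0 c ≡ length c
N-zero c = N-all (All.universal (λ _ → z≤n) c)

absIs? : (i : ℕ) → Decidable (λ x → ∣ x ∣ ≡ i)
absIs? i x = ∣ x ∣ ℕ.≟ i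

countAbs : ℕ → List ℤ → ℕ
countAbs i c = length (filter (absIs? i) c)

module _ {i : ℕ} where
  open ≡-Reasoning

  countAbs-accept : ∀ x c → ∣ x ∣ ≡ i → countAbs i (x ∷ c) ≡ suc (countAbs i c)
  countAbs-accept x c x≡i = cong length (filter-accept (absIs? i) {x} {c} x≡i)

  countAbs-reject : ∀ x c → ∣ x ∣ ≢ i → countAbs i (x ∷ c) ≡ countAbs i c
  countAbs-reject x c x≢i = cong length (filter-reject (absIs? i) {x} {c} x≢i)

  erasePair-keep : ∀ x c → ∣ x ∣ ≢ i → erasePair i (x ∷ c) ≡ x ∷ erasePair i c
  erasePair-keep x c x≢i = filter-accept (¬? ∘ absIs? i) {x} {c} x≢i

  erasePair-drop : ∀ x c → ∣ x ∣ ≡ i → erasePair i (x ∷ c) ≡ erasePair i c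
  erasePair-drop x c x≡i = filter-reject (¬? ∘ absIs? i) {x} {c} (λ x≢i → x≢i x≡i)

  erasePair-++ : ∀ a b → erasePair i (a ++ b) ≡ erasePair i a ++ erasePair i b
  erasePair-++ = filter-++ (¬? ∘ absIs? i)

  erasePair-absent : ∀ {c} → All (λ x → ∣ x ∣ ≢ i) c → erasePair i c ≡ c
  erasePair-absent {c} = filter-all (¬? ∘ absIs? i) {c}

  countAbs≡0 : ∀ c → countAbs i c ≡ 0 → All (λ x → ∣ x ∣ ≢ i) c
  countAbs≡0 c none = All.tabulate λ x∈c x≡i → nonempty (∈-filter⁺ (absIs? i) x∈c x≡i) none
    where
    nonempty : ∀ {x} {xs : List ℤ} → x ∈ xs → length xs ≢ 0
    nonempty (here _)  ()
    nonempty (there _) ()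

  N-countAbs : ∀ c → N i c ≡ countAbs i c + N (suc i) c
  N-countAbs [] = refl
  N-countAbs (x ∷ c) with <-cmp ∣ x ∣ i
  ... | tri< x<i x≢i _ = begin
    N i (x ∷ c)                                   ≡⟨ N-reject x c x<i ⟩
    N i c                                         ≡⟨ N-countAbs c ⟩
    countAbs i c + N (suc i) c                    ≡⟨ cong₂ _+_ (countAbs-reject x c x≢i) (N-reject x c (m<n⇒m<1+n x<i)) ⟨
    countAbs i (x ∷ c) + N (suc i) (x ∷ c)        ∎
  ... | tri≈ _ x≡i _ = begin
    N i (x ∷ c)                                   ≡⟨ N-accept x c (≤-reflexive (sym x≡i)) ⟩
    suc (N i c)                                   ≡⟨ cong suc (N-countAbs c) ⟩
    suc (countAbs i c + N (suc i) c)              ≡⟨ cong₂ _+_ (countAbs-accept x c x≡i) (N-reject x c (s≤s (≤-reflexive x≡i))) ⟨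
    countAbs i (x ∷ c) + N (suc i) (x ∷ c)        ∎
  ... | tri> _ x≢i i<x = begin
    N i (x ∷ c)                                   ≡⟨ N-accept x c (<⇒≤ i<x) ⟩
    suc (N i c)                                   ≡⟨ cong suc (N-countAbs c) ⟩
    suc (countAbs i c + N (suc i) c)              ≡⟨ +-suc _ _ ⟨
    countAbs i c + suc (N (suc i) c)              ≡⟨ cong₂ _+_ (countAbs-reject x c x≢i) (N-accept x c i<x) ⟨
    countAbs i (x ∷ c) + N (suc i) (x ∷ c)        ∎

  N-erasePair-≤ : ∀ {j} c → j ≤ i → N j c ≡ countAbs i c + N j (erasePair i c)
  N-erasePair-≤ [] _ = refl
  N-erasePair-≤ {j} (x ∷ c) j≤i with ∣ x ∣ ℕ.≟ i
  ... | yes x≡i = begin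
    N j (x ∷ c)                                   ≡⟨ N-accept x c (subst (j ≤_) (sym x≡i) j≤i) ⟩
    suc (N j c)                                   ≡⟨ cong suc (N-erasePair-≤ c j≤i) ⟩
    suc (countAbs i c + N j (erasePair i c))      ≡⟨ cong₂ _+_ (countAbs-accept x c x≡i) (cong (N j) (erasePair-drop x c x≡i)) ⟨
    countAbs i (x ∷ c) + N j (erasePair i (x ∷ c)) ∎
  ... | no x≢i with j ℕ.≤? ∣ x ∣
  ...   | yes j≤x = begin
    N j (x ∷ c)                                   ≡⟨ N-accept x c j≤x ⟩
    suc (N j c)                                   ≡⟨ cong suc (N-erasePair-≤ c j≤i) ⟩
    suc (countAbs i c + N j (erasePair i c))      ≡⟨ +-suc _ _ ⟨
    countAbs i c + suc (N j (erasePair i c))      ≡⟨ cong₂ _+_ (countAbs-reject x c x≢i) (N-accept x (erasePair i c) j≤x) ⟨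
    countAbs i (x ∷ c) + N j (x ∷ erasePair i c)  ≡⟨ cong (λ c' → countAbs i (x ∷ c) + N j c') (erasePair-keep x c x≢i) ⟨
    countAbs i (x ∷ c) + N j (erasePair i (x ∷ c)) ∎
  ...   | no j≰x = begin
    N j (x ∷ c)                                   ≡⟨ N-reject x c (≰⇒> j≰x) ⟩
    N j c                                         ≡⟨ N-erasePair-≤ c j≤i ⟩
    countAbs i c + N j (erasePair i c)            ≡⟨ cong₂ _+_ (countAbs-reject x c x≢i) (N-reject x (erasePair i c) (≰⇒> j≰x)) ⟨
    countAbs i (x ∷ c) + N j (x ∷ erasePair i c)  ≡⟨ cong (λ c' → countAbs i (x ∷ c) + N j c') (erasePair-keep x c x≢i) ⟨
    countAbs i (x ∷ c) + N j (erasePair i (x ∷ c)) ∎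

  N-erasePair-> : ∀ {j} c → i < j → N j (erasePair i c) ≡ N j c
  N-erasePair-> [] _ = refl
  N-erasePair-> {j} (x ∷ c) i<j with ∣ x ∣ ℕ.≟ i
  ... | yes x≡i = begin
    N j (erasePair i (x ∷ c))                     ≡⟨ cong (N j) (erasePair-drop x c x≡i) ⟩
    N j (erasePair i c)                           ≡⟨ N-erasePair-> c i<j ⟩
    N j c                                         ≡⟨ N-reject x c (subst (_< j) (sym x≡i) i<j) ⟨
    N j (x ∷ c)                                   ∎
  ... | no x≢i = trans (cong (N j) (erasePair-keep x c x≢i)) (N-cons-cong (N-erasePair-> c i<j))
    where
    N-cons-cong : ∀ {c₁ c₂} → N j c₁ ≡ N j c₂ → N j (x ∷ c₁) ≡ N j (x ∷ c₂)
    N-cons-cong {c₁} {c₂} eq = trans (N-++ [ x ] c₁) (trans (cong (N j [ x ] +_) eq) (sym (N-++ [ x ] c₂)))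

length-erasePair : ∀ i c → length c ≡ countAbs i c + length (erasePair i c)
length-erasePair i c = begin
  length c                                ≡⟨ N-zero c ⟨
  N 0 c                                   ≡⟨ N-erasePair-≤ c z≤n ⟩
  countAbs i c + N 0 (erasePair i c)      ≡⟨ cong (countAbs i c +_) (N-zero (erasePair i c)) ⟩
  countAbs i c + length (erasePair i c)   ∎
  where open ≡-Reasoning

<-sameAbs : ∀ {x y} → ∣ x ∣ ≡ ∣ y ∣ → x ℤ.< y → ∃[ k ] x ≡ -[1+ k ] × y ≡ ℤ.+ suc k
<-sameAbs {ℤ.+ _}     {ℤ.+ _}     refl (ℤ.+<+ m<m) = contradiction m<m (<-irrefl refl)
<-sameAbs { -[1+ k ]} {ℤ.+ _}     refl ℤ.-<+       = k , refl , refl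
<-sameAbs { -[1+ _ ]} { -[1+ _ ]} refl (ℤ.-<- m<m) = contradiction m<m (<-irrefl refl)

module _ {i : ℕ} where

  sameAbs-length≤2 : ∀ {xs} → Increasing xs → All (λ x → ∣ x ∣ ≡ i) xs → length xs ≤ 2
  sameAbs-length≤2 {[]}            _ _ = z≤n
  sameAbs-length≤2 {_ ∷ []}        _ _ = s≤s z≤n
  sameAbs-length≤2 {_ ∷ _ ∷ []}    _ _ = s≤s (s≤s z≤n)
  sameAbs-length≤2 {x ∷ y ∷ z ∷ _} ((x<y ∷ _) ∷ (y<z ∷ _) ∷ _) (x≡i ∷ y≡i ∷ z≡i ∷ _)
    with <-sameAbs (trans x≡i (sym y≡i)) x<y | <-sameAbs (trans y≡i (sym z≡i)) y<z
  ... | _ , _ , refl | _ , () , _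

  sameAbs-PairIn : ∀ {xs} → Increasing xs → All (λ x → ∣ x ∣ ≡ i) xs → 2 ≤ length xs → PairIn i xs
  sameAbs-PairIn {x ∷ y ∷ _} ((x<y ∷ _) ∷ _) (x≡i ∷ refl ∷ _) _
    with <-sameAbs (trans x≡i refl) x<y
  ... | _ , refl , refl = here refl , there (here refl)
  sameAbs-PairIn {_ ∷ []} _ _ (s≤s ())

∣-t∣≡t : ∀ t → ∣ ℤ.- (ℤ.+ t) ∣ ≡ t
∣-t∣≡t t = ℤₚ.∣-i∣≡∣i∣ (ℤ.+ t)

-t≢t : ∀ {t} → 1 ≤ t → ℤ.- (ℤ.+ t) ≢ ℤ.+ t
-t≢t (s≤s z≤n) ()

distinct∈⇒2≤length : ∀ {a b : ℤ} {xs} → a ∈ xs → b ∈ xs → a ≢ b → 2 ≤ length xs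
distinct∈⇒2≤length {xs = _ ∷ _ ∷ _} _           _           _   = s≤s (s≤s z≤n)
distinct∈⇒2≤length {xs = _ ∷ []}    (here refl) (here refl) a≢b = contradiction refl a≢b

module _ {i : ℕ} {c : List ℤ} (c↑ : Increasing c) where

  private
    sameAbs : List ℤ
    sameAbs = filter (absIs? i) c

    sameAbs↑ : Increasing sameAbs
    sameAbs↑ = AllPairs.filter⁺ (absIs? i) c↑

    sameAbs-all : All (λ x → ∣ x ∣ ≡ i) sameAbs
    sameAbs-all = All.all-filter (absIs? i) c

  countAbs≥2⇒PairIn : 2 ≤ countAbs i c → PairIn i c
  countAbs≥2⇒PairIn two with sameAbs-PairIn sameAbs↑ sameAbs-all two
  ... | neg∈ , pos∈ = proj₁ (∈-filter⁻ (absIs? i) neg∈) , proj₁ (∈-filter⁻ (absIs? i) pos∈)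

  PairIn⇒countAbs≡2 : 1 ≤ i → PairIn i c → countAbs i c ≡ 2
  PairIn⇒countAbs≡2 1≤i (neg∈ , pos∈) = ≤-antisym
    (sameAbs-length≤2 sameAbs↑ sameAbs-all)
    (distinct∈⇒2≤length (∈-filter⁺ (absIs? i) neg∈ (∣-t∣≡t i)) (∈-filter⁺ (absIs? i) pos∈ refl) (-t≢t 1≤i))

-- Levels and the peak

∣letter∣≤n : ∀ {n x} → IsLetter n x → ∣ x ∣ ≤ n
∣letter∣≤n {x = ℤ.+ _}                (_ , _ , ℤ.+≤+ m≤n) = m≤n
∣letter∣≤n {n = suc _} {x = -[1+ _ ]} (_ , ℤ.-≤- m≤n , _) = s≤s m≤n

1≤∣letter∣ : ∀ {n x} → IsLetter n x → 1 ≤ ∣ x ∣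
1≤∣letter∣ {x = ℤ.+ zero}  (x≢0 , _) = contradiction refl x≢0
1≤∣letter∣ {x = ℤ.+ suc _} _         = s≤s z≤n
1≤∣letter∣ {x = -[1+ _ ]}  _         = s≤s z≤n

level : List ℤ → ℕ → ℕ
level c j = N j c + j

peak : ℕ → List ℤ → ℕ
peak n c = max (suc n) (applyUpTo (λ j → level c (suc j)) n)

module _ {n : ℕ} (c : List ℤ) where

  private
    levels : List ℕ
    levels = applyUpTo (λ j → level c (suc j)) n

  suc≤peak : suc n ≤ peak n c
  suc≤peak = ⊥≤max (suc n) levels

  level≤peak : ∀ {j} → 1 ≤ j → j ≤ n → level c j ≤ peak n c
  level≤peak {suc j} _ j<n = All.applyUpTo⁻ _ n (xs≤max (suc n) levels) j<n

  peak≤ : ∀ {B} → suc n ≤ B → (∀ j → 1 ≤ j → j ≤ n → level c j ≤ B) → peak n c ≤ B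
  peak≤ n<B levels≤B = max≤v⁺ n<B (All.applyUpTo⁺₁ _ n (levels≤B _ (s≤s z≤n)))

  peak-attained : peak n c ≡ suc n ⊎ ∃[ j ] 1 ≤ j × j ≤ n × level c j ≡ peak n c
  peak-attained with argmax-sel id (suc n) levels
  ... | inj₁ peak≡n+1 = inj₁ peak≡n+1
  ... | inj₂ peak∈ with ∈-applyUpTo⁻ _ peak∈
  ...   | j , j<n , peak≡ = inj₂ (suc j , s≤s z≤n , j<n , sym peak≡)

  module _ (letters : All (IsLetter n) c) where

    level-beyond : level c (suc n) ≡ suc n
    level-beyond = cong (_+ suc n) (N-none (All.map (s≤s ∘ ∣letter∣≤n) letters))

    level-one : level c 1 ≡ suc (length c)
    level-one = trans (cong (_+ 1) (N-all (All.map 1≤∣letter∣ letters))) (+-comm (length c) 1)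

    level≤peak-letters : ∀ {j} → 1 ≤ j → j ≤ suc n → level c j ≤ peak n c
    level≤peak-letters {j} 1≤j j≤n+1 with j ℕ.≟ suc n
    ... | yes refl = subst (_≤ peak n c) (sym level-beyond) suc≤peak
    ... | no j≢n+1 = level≤peak 1≤j (≤-pred (≤∧≢⇒< j≤n+1 j≢n+1))

    peak-attained-letters : ∃[ j ] 1 ≤ j × j ≤ suc n × level c j ≡ peak n c
    peak-attained-letters with peak-attained
    ... | inj₁ peak≡n+1               = suc n , s≤s z≤n , ≤-refl , trans level-beyond (sym peak≡n+1)
    ... | inj₂ (j , 1≤j , j≤n , eq) = j , 1≤j , m≤n⇒m≤1+n j≤n , eq

module _ {n j : ℕ} (j≤n : j ≤ n) where

  n∸j+k+j≡k+n : ∀ k → n ∸ j + k + j ≡ k + n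
  n∸j+k+j≡k+n k = begin
    n ∸ j + k + j     ≡⟨ +-assoc (n ∸ j) k j ⟩
    n ∸ j + (k + j)   ≡⟨ cong (n ∸ j +_) (+-comm k j) ⟩
    n ∸ j + (j + k)   ≡⟨ +-assoc (n ∸ j) j k ⟨
    n ∸ j + j + k     ≡⟨ cong (_+ k) (m∸n+n≡m j≤n) ⟩
    n + k             ≡⟨ +-comm n k ⟩
    k + n             ∎
    where open ≡-Reasoning

  ≤∸+⇒+≤ : ∀ {a} k → a ≤ n ∸ j + k → a + j ≤ k + n
  ≤∸+⇒+≤ {a} k a≤ = subst (a + j ≤_) (n∸j+k+j≡k+n k) (+-monoˡ-≤ j a≤)

  +≤⇒≤∸+ : ∀ {a} k → a + j ≤ k + n → a ≤ n ∸ j + k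
  +≤⇒≤∸+ {a} k a+j≤ = +-cancelʳ-≤ j _ _ (subst (a + j ≤_) (sym (n∸j+k+j≡k+n k)) a+j≤)

  ≡∸+⇒+≡ : ∀ {a} k → a ≡ n ∸ j + k → a + j ≡ k + n
  ≡∸+⇒+≡ k a≡ = trans (cong (_+ j) a≡) (n∸j+k+j≡k+n k)

  +≡⇒≡∸+ : ∀ {a} k → a + j ≡ k + n → a ≡ n ∸ j + k
  +≡⇒≡∸+ k a+j≡ = +-cancelʳ-≡ j _ _ (trans a+j≡ (sym (n∸j+k+j≡k+n k)))

module _ {n : ℕ} (c : List ℤ) where

  admissible⇒level≤ : Admissible n c → ∀ j → 1 ≤ j → j ≤ n → level c j ≤ suc n
  admissible⇒level≤ adm j 1≤j j≤n = ≤∸+⇒+≤ j≤n 1 (adm j 1≤j j≤n)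

  level≤⇒admissible : (∀ j → 1 ≤ j → j ≤ n → level c j ≤ suc n) → Admissible n c
  level≤⇒admissible levels≤ j 1≤j j≤n = +≤⇒≤∸+ j≤n 1 (levels≤ j 1≤j j≤n)

  peak-admissible : Admissible n c → peak n c ≡ suc n
  peak-admissible adm = ≤-antisym (peak≤ c ≤-refl (admissible⇒level≤ adm)) (suc≤peak c)

-- Contractions lower the peak by one

increasing-++⁻ʳ : ∀ a {b} → Increasing (a ++ b) → Increasing b
increasing-++⁻ʳ []      ab↑       = ab↑
increasing-++⁻ʳ (_ ∷ a) (_ ∷ ab↑) = increasing-++⁻ʳ a ab↑

increasing-++⁻ˡ : ∀ a {b} → Increasing (a ++ b) → Increasing a
increasing-++⁻ˡ []      _            = []
increasing-++⁻ˡ (_ ∷ a) (x<ab ∷ ab↑) = All.++⁻ˡ a x<ab ∷ increasing-++⁻ˡ a ab↑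

increasing-++-< : ∀ a {b y z} → Increasing (a ++ b) → y ∈ a → z ∈ b → y ℤ.< z
increasing-++-< (_ ∷ a) (y<ab ∷ _) (here refl) z∈b = All.lookup y<ab (∈-++⁺ʳ a z∈b)
increasing-++-< (_ ∷ a) (_ ∷ ab↑)  (there y∈a) z∈b = increasing-++-< a ab↑ y∈a z∈b

<-neg⇒<∣∣ : ∀ {i x} → x ℤ.< ℤ.- (ℤ.+ i) → i < ∣ x ∣
<-neg⇒<∣∣ {zero}  { -[1+ _ ]} _           = s≤s z≤n
<-neg⇒<∣∣ {zero}  {ℤ.+ _}     (ℤ.+<+ ())
<-neg⇒<∣∣ {suc _} { -[1+ _ ]} (ℤ.-<- i<m) = s≤s i<m

pos<⇒<∣∣ : ∀ {i x} → ℤ.+ i ℤ.< x → i < ∣ x ∣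
pos<⇒<∣∣ {x = ℤ.+ _} (ℤ.+<+ i<m) = i<m

level-sandwich : ∀ j u v w → level (u ++ v ++ w) j ≡ (N j u + N j w) + level v j
level-sandwich j u v w = begin
  N j (u ++ v ++ w) + j            ≡⟨ cong (_+ j) (trans (N-++ u (v ++ w)) (cong (N j u +_) (N-++ v w))) ⟩
  N j u + (N j v + N j w) + j      ≡⟨ rearrange (N j u) (N j v) (N j w) j ⟩
  (N j u + N j w) + (N j v + j)    ∎
  where
  open ≡-Reasoning
  rearrange : ∀ a b c d → a + (b + c) + d ≡ (a + c) + (b + d)
  rearrange = solve-∀

level-suc : ∀ j c → suc (level c j) ≡ countAbs j c + level c (suc j)
level-suc j c = trans (cong (λ m → suc (m + j)) (N-countAbs c)) (rearrange (countAbs j c) (N (suc j) c) j)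
  where
  rearrange : ∀ a b d → suc (a + b + d) ≡ a + (b + suc d)
  rearrange = solve-∀

peak-sandwich : ∀ {n s B} u v w → All (IsLetter n) (u ++ v ++ w) → 1 ≤ s → s ≤ suc n → suc n ≤ B →
                All (λ x → s ≤ ∣ x ∣) u → All (λ x → s ≤ ∣ x ∣) w →
                (∀ j → 1 ≤ j → j ≤ n → level v j ≤ B) → level v s ≡ B →
                peak n (u ++ v ++ w) ≡ (length u + length w) + B
peak-sandwich {n} {s} {B} u v w letters 1≤s s≤n+1 n<B u-large w-large levels≤B levelₛ≡B =
  ≤-antisym (peak≤ (u ++ v ++ w) (≤-trans n<B (m≤n+m B _)) level≤)
            (subst (_≤ peak n (u ++ v ++ w)) levelₛ≡ (level≤peak-letters (u ++ v ++ w) letters 1≤s s≤n+1))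
  where
  level≤ : ∀ j → 1 ≤ j → j ≤ n → level (u ++ v ++ w) j ≤ (length u + length w) + B
  level≤ j 1≤j j≤n = subst (_≤ (length u + length w) + B) (sym (level-sandwich j u v w))
    (+-mono-≤ (+-mono-≤ (N≤length u) (N≤length w)) (levels≤B j 1≤j j≤n))
  levelₛ≡ : level (u ++ v ++ w) s ≡ (length u + length w) + B
  levelₛ≡ = trans (level-sandwich s u v w) (cong₂ _+_ (cong₂ _+_ (N-all u-large) (N-all w-large)) levelₛ≡B)

minNonAdmissible⇒level≤ : ∀ {n v} → MinNonAdmissible n v → ∀ j → 1 ≤ j → j ≤ n → level v j ≤ 2 + n
minNonAdmissible⇒level≤ {v = []} (¬adm , _) _ _ _ =
  contradiction (level≤⇒admissible [] λ _ _ j≤n → m≤n⇒m≤1+n j≤n) ¬adm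
minNonAdmissible⇒level≤ {n} {x ∷ r} (_ , strict) j 1≤j j≤n =
  ≤-trans (+-monoˡ-≤ j (≤-trans (≤-reflexive (N-++ [ x ] r)) (+-monoˡ-≤ (N j r) (N≤length [ x ]))))
          (s≤s (admissible⇒level≤ r r-admissible j 1≤j j≤n))
  where
  r-admissible : Admissible n r
  r-admissible = strict [ x ] r [] (cong (x ∷_) (sym (++-identityʳ r))) (inj₁ λ ())

module _ {i : ℕ} {v : List ℤ} (v↑ : Increasing v) (1≤i : 1 ≤ i) (pair : PairIn i v) where

  private
    countAbs≡2 : countAbs i v ≡ 2
    countAbs≡2 = PairIn⇒countAbs≡2 v↑ 1≤i pair

  level-erasePair-≤ : ∀ j → j ≤ i → level v j ≡ 2 + level (erasePair i v) j
  level-erasePair-≤ j j≤i = cong (_+ j) (trans (N-erasePair-≤ v j≤i) (cong (_+ N j (erasePair i v)) countAbs≡2))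

  level-erasePair-> : ∀ j → i < j → level (erasePair i v) j ≡ level v j
  level-erasePair-> j i<j = cong (_+ j) (N-erasePair-> v i<j)

  level-at-pair : level v i ≡ suc (level v (suc i))
  level-at-pair = suc-injective (trans (level-suc i v) (cong (_+ level v (suc i)) countAbs≡2))

module _ {n i : ℕ} {v : List ℤ} (v↑ : Increasing v) (letters : All (IsLetter n) v)
         (mna : MinNonAdmissible n v) (index : ContractionIndex n v i) where

  -- Downward induction on j: a level n + 2 at j next to a level at most n + 1 at j + 1 forces
  -- the pair (j̄, j) into v, against the maximality of the contraction index i.
  level-above-contractionIndex : ∀ j → i < j → j ≤ n → level v j ≤ suc n
  level-above-contractionIndex j i<j j≤n = descend (suc n ∸ j) j (m∸n+n≡m (m≤n⇒m≤1+n j≤n)) i<j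
    where
    descend : ∀ d j → d + j ≡ suc n → i < j → level v j ≤ suc n
    descend zero    j refl _ = ≤-reflexive (level-beyond v letters)
    descend (suc d) j d+j≡n i<j with level v j ≤? suc n
    ... | yes level≤ = level≤
    ... | no level≰ = contradiction (+≡⇒≡∸+ j≤n′ 2 level≡) (maximal j i<j j≤n′ (countAbs≥2⇒PairIn v↑ two))
      where
      maximal : ∀ j → i < j → j ≤ n → PairIn j v → N j v ≢ n ∸ j + 2
      maximal = proj₂ (proj₂ (proj₂ (proj₂ index)))
      j≤n′ : j ≤ n
      j≤n′ = subst (j ≤_) (suc-injective d+j≡n) (m≤n+m j d)
      level≡ : level v j ≡ 2 + n
      level≡ = ≤-antisym (minNonAdmissible⇒level≤ mna j (≤-trans (s≤s z≤n) i<j) j≤n′) (≰⇒> level≰)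
      level-next≤ : level v (suc j) ≤ suc n
      level-next≤ = descend d (suc j) (trans (+-suc d j) d+j≡n) (m<n⇒m<1+n i<j)
      two : 2 ≤ countAbs j v
      two = +-cancelʳ-≤ (suc n) 2 (countAbs j v) (begin
        2 + suc n                          ≡⟨ cong suc level≡ ⟨
        suc (level v j)                    ≡⟨ level-suc j v ⟩
        countAbs j v + level v (suc j)     ≤⟨ +-monoʳ-≤ (countAbs j v) level-next≤ ⟩
        countAbs j v + suc n               ∎)
        where open ≤-Reasoning

module _ {n i : ℕ} (u v w : List ℤ) (c↑ : Increasing (u ++ v ++ w)) (letters : All (IsLetter n) (u ++ v ++ w))
         (mna : MinNonAdmissible n v) (index : ContractionIndex n v i) where

  private
    1≤i : 1 ≤ i
    1≤i = proj₁ index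

    i≤n : i ≤ n
    i≤n = proj₁ (proj₂ index)

    pair : PairIn i v
    pair = proj₁ (proj₂ (proj₂ index))

    Nᵢ≡ : N i v ≡ n ∸ i + 2
    Nᵢ≡ = proj₁ (proj₂ (proj₂ (proj₂ index)))

    v↑ : Increasing v
    v↑ = increasing-++⁻ˡ v (increasing-++⁻ʳ u c↑)

    vᵢ : List ℤ
    vᵢ = erasePair i v

    u-large : All (λ x → i < ∣ x ∣) u
    u-large = All.tabulate λ x∈u → <-neg⇒<∣∣ (increasing-++-< u c↑ x∈u (∈-++⁺ˡ (proj₁ pair)))

    w-large : All (λ x → i < ∣ x ∣) w
    w-large = All.tabulate λ x∈w →
      pos<⇒<∣∣ (increasing-++-< (u ++ v) (subst Increasing (sym (++-assoc u v w)) c↑) (∈-++⁺ʳ u (proj₂ pair)) x∈w)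

    absent : ∀ {a} → All (λ x → i < ∣ x ∣) a → All (λ x → ∣ x ∣ ≢ i) a
    absent = All.map λ i<x x≡i → <-irrefl (sym x≡i) i<x

  erasePair-factor : erasePair i (u ++ v ++ w) ≡ u ++ vᵢ ++ w
  erasePair-factor = begin
    erasePair i (u ++ v ++ w)                        ≡⟨ erasePair-++ u (v ++ w) ⟩
    erasePair i u ++ erasePair i (v ++ w)            ≡⟨ cong (erasePair i u ++_) (erasePair-++ v w) ⟩
    erasePair i u ++ vᵢ ++ erasePair i w
      ≡⟨ cong₂ (λ a b → a ++ vᵢ ++ b) (erasePair-absent (absent u-large)) (erasePair-absent (absent w-large)) ⟩
    u ++ vᵢ ++ w                                     ∎
    where open ≡-Reasoning

  length-factor-contraction : length (u ++ v ++ w) ≡ 2 + length (u ++ vᵢ ++ w)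
  length-factor-contraction = begin
    length (u ++ v ++ w)
      ≡⟨ length-erasePair i (u ++ v ++ w) ⟩
    countAbs i (u ++ v ++ w) + length (erasePair i (u ++ v ++ w))
      ≡⟨ cong₂ _+_ (PairIn⇒countAbs≡2 c↑ 1≤i pairᶜ) (cong length erasePair-factor) ⟩
    2 + length (u ++ vᵢ ++ w)
      ∎
    where
    open ≡-Reasoning
    pairᶜ : PairIn i (u ++ v ++ w)
    pairᶜ = ∈-++⁺ʳ u (∈-++⁺ˡ (proj₁ pair)) , ∈-++⁺ʳ u (∈-++⁺ˡ (proj₂ pair))

  peak-factor-contraction : peak n (u ++ v ++ w) ≡ suc (peak n (u ++ vᵢ ++ w))
  peak-factor-contraction = begin
    peak n (u ++ v ++ w)
      ≡⟨ peak-sandwich u v w letters 1≤i (m≤n⇒m≤1+n i≤n) (n≤1+n _)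
                       (All.map <⇒≤ u-large) (All.map <⇒≤ w-large) levels≤ levelᵢ≡ ⟩
    L + (2 + n)
      ≡⟨ +-suc L (suc n) ⟩
    suc (L + suc n)
      ≡⟨ cong suc (peak-sandwich u vᵢ w lettersᵢ (s≤s z≤n) (s≤s i≤n) ≤-refl u-large w-large levelsᵢ≤ levelᵢ₊₁≡) ⟨
    suc (peak n (u ++ vᵢ ++ w))
      ∎
    where
    open ≡-Reasoning
    L : ℕ
    L = length u + length w
    levels≤ : ∀ j → 1 ≤ j → j ≤ n → level v j ≤ 2 + n
    levels≤ = minNonAdmissible⇒level≤ mna
    levelᵢ≡ : level v i ≡ 2 + n
    levelᵢ≡ = ≡∸+⇒+≡ i≤n 2 Nᵢ≡
    lettersᵢ : All (IsLetter n) (u ++ vᵢ ++ w)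
    lettersᵢ = subst (All (IsLetter n)) erasePair-factor (All.filter⁺ (¬? ∘ absIs? i) letters)
    levelsᵢ≤ : ∀ j → 1 ≤ j → j ≤ n → level vᵢ j ≤ suc n
    levelsᵢ≤ j 1≤j j≤n with j ≤? i
    ... | yes j≤i = m≤n⇒m≤1+n (+-cancelˡ-≤ 2 _ _
                      (subst (_≤ 2 + n) (level-erasePair-≤ v↑ 1≤i pair j j≤i) (levels≤ j 1≤j j≤n)))
    ... | no j≰i = subst (_≤ suc n) (sym (level-erasePair-> v↑ 1≤i pair j (≰⇒> j≰i)))
                     (level-above-contractionIndex v↑ (All.++⁻ˡ v (All.++⁻ʳ u letters)) mna index j (≰⇒> j≰i) j≤n)
    levelᵢ₊₁≡ : level vᵢ (suc i) ≡ suc n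
    levelᵢ₊₁≡ = trans (level-erasePair-> v↑ 1≤i pair (suc i) ≤-refl)
                      (suc-injective (trans (sym (level-at-pair v↑ 1≤i pair)) levelᵢ≡))

length-contraction : ∀ {n c c'} → Contraction n c c' → length c ≡ 2 + length c'
length-contraction (contract u v w _ (c↑ , letters) refl mna index refl) =
  length-factor-contraction u v w (Linked⇒AllPairs ℤₚ.<-trans c↑) letters mna index

peak-contraction : ∀ {n c c'} → Contraction n c c' → peak n c ≡ suc (peak n c')
peak-contraction (contract u v w _ (c↑ , letters) refl mna index refl) =
  peak-factor-contraction u v w (Linked⇒AllPairs ℤₚ.<-trans c↑) letters mna index

-- Columns admitting no dilatation

insert : ℤ → List ℤ → List ℤ
insert x []      = [ x ]
insert x (y ∷ c) with x ℤ.<? y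
... | yes _ = x ∷ y ∷ c
... | no _  = y ∷ insert x c

insert-↭ : ∀ x c → insert x c ↭ x ∷ c
insert-↭ x []      = ↭-refl
insert-↭ x (y ∷ c) with x ℤ.<? y
... | yes _ = ↭-refl
... | no _  = ↭-trans (prep y (insert-↭ x c)) (swap y x ↭-refl)

insert-increasing : ∀ {x c} → All (x ≢_) c → Increasing c → Increasing (insert x c)
insert-increasing {x} {[]}    _              _          = [] ∷ []
insert-increasing {x} {y ∷ c} (x≢y ∷ x∉c) (y<c ∷ c↑) with x ℤ.<? y
... | yes x<y = (x<y ∷ All.map (ℤₚ.<-trans x<y) y<c) ∷ y<c ∷ c↑
... | no x≮y  = All-resp-↭ (↭-sym (insert-↭ x c)) (y<x ∷ y<c) ∷ insert-increasing x∉c c↑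
  where
  y<x : y ℤ.< x
  y<x = ℤₚ.≤∧≢⇒< (ℤₚ.≮⇒≥ x≮y) (x≢y ∘ sym)

erasePair-insert : ∀ {i x} c → ∣ x ∣ ≡ i → erasePair i (insert x c) ≡ erasePair i c
erasePair-insert {i} {x} []      x≡i = erasePair-drop x [] x≡i
erasePair-insert {i} {x} (y ∷ c) x≡i with x ℤ.<? y
... | yes _ = erasePair-drop x (y ∷ c) x≡i
... | no _ with ∣ y ∣ ℕ.≟ i
...   | yes y≡i = trans (erasePair-drop y (insert x c) y≡i)
                         (trans (erasePair-insert c x≡i) (sym (erasePair-drop y c y≡i)))
...   | no y≢i  = trans (erasePair-keep y (insert x c) y≢i)
                         (trans (cong (y ∷_) (erasePair-insert c x≡i)) (sym (erasePair-keep y c y≢i)))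

withPair : ℕ → List ℤ → List ℤ
withPair t d = insert (ℤ.- (ℤ.+ t)) (insert (ℤ.+ t) d)

±t-letters : ∀ {n t} → 1 ≤ t → t ≤ n → IsLetter n (ℤ.+ t) × IsLetter n (ℤ.- (ℤ.+ t))
±t-letters {suc _} {suc _} _ (s≤s t≤n) = ((λ ()) , ℤ.-≤+ , ℤ.+≤+ (s≤s t≤n)) , ((λ ()) , ℤ.-≤- t≤n , ℤ.-≤+)

module _ {t : ℕ} {d : List ℤ} where

  withPair-↭ : withPair t d ↭ ℤ.- (ℤ.+ t) ∷ ℤ.+ t ∷ d
  withPair-↭ = ↭-trans (insert-↭ _ _) (prep _ (insert-↭ _ _))

  PairIn-withPair : PairIn t (withPair t d)
  PairIn-withPair = ∈-resp-↭ (↭-sym withPair-↭) (here refl) , ∈-resp-↭ (↭-sym withPair-↭) (there (here refl))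

  level-withPair-≤ : ∀ j → j ≤ t → level (withPair t d) j ≡ 2 + level d j
  level-withPair-≤ j j≤t = cong (_+ j) (begin
    N j (withPair t d)                  ≡⟨ N-resp-↭ withPair-↭ ⟩
    N j (ℤ.- (ℤ.+ t) ∷ ℤ.+ t ∷ d)      ≡⟨ N-accept (ℤ.- (ℤ.+ t)) (ℤ.+ t ∷ d) (subst (j ≤_) (sym (∣-t∣≡t t)) j≤t) ⟩
    suc (N j (ℤ.+ t ∷ d))               ≡⟨ cong suc (N-accept (ℤ.+ t) d j≤t) ⟩
    2 + N j d                           ∎)
    where open ≡-Reasoning

  level-withPair-> : ∀ j → t < j → level (withPair t d) j ≡ level d j
  level-withPair-> j t<j = cong (_+ j) (begin
    N j (withPair t d)                  ≡⟨ N-resp-↭ withPair-↭ ⟩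
    N j (ℤ.- (ℤ.+ t) ∷ ℤ.+ t ∷ d)      ≡⟨ N-reject (ℤ.- (ℤ.+ t)) (ℤ.+ t ∷ d) (subst (_< j) (sym (∣-t∣≡t t)) t<j) ⟩
    N j (ℤ.+ t ∷ d)                     ≡⟨ N-reject (ℤ.+ t) d t<j ⟩
    N j d                               ∎)
    where open ≡-Reasoning

  module _ (t-absent : All (λ x → ∣ x ∣ ≢ t) d) where

    erasePair-withPair : erasePair t (withPair t d) ≡ d
    erasePair-withPair = begin
      erasePair t (withPair t d)         ≡⟨ erasePair-insert (insert (ℤ.+ t) d) (∣-t∣≡t t) ⟩
      erasePair t (insert (ℤ.+ t) d)     ≡⟨ erasePair-insert d refl ⟩
      erasePair t d                      ≡⟨ erasePair-absent t-absent ⟩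
      d                                  ∎
      where open ≡-Reasoning

    withPair-column : ∀ {n} → 1 ≤ t → t ≤ n → IsColumn n d → IsColumn n (withPair t d)
    withPair-column {n} 1≤t t≤n (d↑ , letters) =
      AllPairs⇒Linked (insert-increasing -t∉ (insert-increasing t∉ (Linked⇒AllPairs ℤₚ.<-trans d↑))) ,
      All-resp-↭ (↭-sym withPair-↭) (proj₂ (±t-letters 1≤t t≤n) ∷ proj₁ (±t-letters 1≤t t≤n) ∷ letters)
      where
      t∉ : All (ℤ.+ t ≢_) d
      t∉ = All.map (λ x≢t t≡x → x≢t (cong ∣_∣ (sym t≡x))) t-absent
      -t∉ : All (ℤ.- (ℤ.+ t) ≢_) (insert (ℤ.+ t) d)
      -t∉ = All-resp-↭ (↭-sym (insert-↭ _ d))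
              (-t≢t 1≤t ∷ All.map (λ x≢t -t≡x → x≢t (trans (cong ∣_∣ (sym -t≡x)) (∣-t∣≡t t))) t-absent)

MaxLevelAt : ℕ → ℕ → List ℤ → Set
MaxLevelAt n t v = (∀ j → 1 ≤ j → j ≤ t → level v j ≤ level v t) × (∀ j → t < j → j ≤ n → level v j < level v t)

prefix-large : ∀ {t} a {r} → Increasing (a ++ r) → ℤ.- (ℤ.+ t) ∈ a ++ r → a ≢ [] → Any (λ y → t ≤ ∣ y ∣) a
prefix-large []      _    _  a≢[] = contradiction refl a≢[]
prefix-large {t} (y ∷ a) ar↑ ī∈ _ with ∈-++⁻ (y ∷ a) ī∈
... | inj₁ ī∈a  = Any.map (λ { refl → ≤-reflexive (sym (∣-t∣≡t t)) }) ī∈a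
... | inj₂ ī∈r  = here (<⇒≤ (<-neg⇒<∣∣ (increasing-++-< (y ∷ a) ar↑ (here refl) ī∈r)))

suffix-large : ∀ {t} l {b} → Increasing (l ++ b) → ℤ.+ t ∈ l ++ b → b ≢ [] → Any (λ y → t ≤ ∣ y ∣) b
suffix-large l {[]}    _   _  b≢[] = contradiction refl b≢[]
suffix-large l {z ∷ b} lb↑ t∈ _ with ∈-++⁻ l t∈
... | inj₁ t∈l = here (<⇒≤ (pos<⇒<∣∣ (increasing-++-< l lb↑ t∈l (here refl))))
... | inj₂ t∈b = Any.map (λ { refl → ≤-refl }) t∈b

module _ {n t : ℕ} (1≤t : 1 ≤ t) (t≤n : t ≤ n) {v : List ℤ} (v↑ : Increasing v) (pair : PairIn t v)
         (v-max : MaxLevelAt n t v) (levelₜ≡ : level v t ≡ 2 + n) where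

  private
    below : ∀ j → 1 ≤ j → j ≤ t → level v j ≤ level v t
    below = proj₁ v-max

    above : ∀ j → t < j → j ≤ n → level v j < level v t
    above = proj₂ v-max

  contractionIndex-at-peak : ContractionIndex n v t
  contractionIndex-at-peak = 1≤t , t≤n , pair , +≡⇒≡∸+ t≤n 2 levelₜ≡ , not-index
    where
    not-index : ∀ j → t < j → j ≤ n → PairIn j v → N j v ≢ n ∸ j + 2
    not-index j t<j j≤n _ Nⱼ≡ = <-irrefl (trans (≡∸+⇒+≡ j≤n 2 Nⱼ≡) (sym levelₜ≡)) (above j t<j j≤n)

  strictFactor-admissible : ∀ a x b → v ≡ a ++ x ++ b → a ≢ [] ⊎ b ≢ [] → Admissible n x
  strictFactor-admissible a x b v≡ nonempty = level≤⇒admissible x level≤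
    where
    axb↑ : Increasing (a ++ x ++ b)
    axb↑ = subst Increasing v≡ v↑
    outer-count : ∀ {j} → j ≤ t → a ≢ [] ⊎ b ≢ [] → 1 ≤ N j a + N j b
    outer-count j≤t (inj₁ a≢[]) = ≤-trans (N-some (Any.map (≤-trans j≤t)
                        (prefix-large a axb↑ (subst (_ ∈_) v≡ (proj₁ pair)) a≢[]))) (m≤m+n _ _)
    outer-count j≤t (inj₂ b≢[]) = ≤-trans (N-some (Any.map (≤-trans j≤t)
                        (suffix-large (a ++ x) (subst Increasing (sym (++-assoc a x b)) axb↑)
                                      (subst (_ ∈_) (trans v≡ (sym (++-assoc a x b))) (proj₂ pair)) b≢[]))) (m≤n+m _ _)
    level-split : ∀ j → level v j ≡ (N j a + N j b) + level x j
    level-split j = trans (cong (λ c → level c j) v≡) (level-sandwich j a x b)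
    level≤ : ∀ j → 1 ≤ j → j ≤ n → level x j ≤ suc n
    level≤ j 1≤j j≤n with j ≤? t
    ... | yes j≤t = ≤-pred (begin
      1 + level x j                    ≤⟨ +-monoˡ-≤ (level x j) (outer-count j≤t nonempty) ⟩
      (N j a + N j b) + level x j      ≡⟨ level-split j ⟨
      level v j                        ≤⟨ below j 1≤j j≤t ⟩
      level v t                        ≡⟨ levelₜ≡ ⟩
      2 + n                            ∎)
      where open ≤-Reasoning
    ... | no j≰t = ≤-pred (begin-strict
      level x j                        ≤⟨ m≤n+m (level x j) (N j a + N j b) ⟩
      (N j a + N j b) + level x j      ≡⟨ level-split j ⟨
      level v j                        <⟨ above j (≰⇒> j≰t) j≤n ⟩
      level v t                        ≡⟨ levelₜ≡ ⟩
      2 + n                            ∎)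
      where open ≤-Reasoning

  minNonAdmissible-at-peak : MinNonAdmissible n v
  minNonAdmissible-at-peak = ¬admissible , strictFactor-admissible
    where
    ¬admissible : ¬ Admissible n v
    ¬admissible adm = <-irrefl refl (subst (_≤ suc n) levelₜ≡ (admissible⇒level≤ v adm t 1≤t t≤n))

  contraction-at-peak : ∀ {e d u w} → IsColumn n e → e ≡ u ++ v ++ w → d ≡ u ++ erasePair t v ++ w → Contraction n e d
  contraction-at-peak {u = u} {w} e-column e≡ d≡ =
    contract u v w t e-column e≡ minNonAdmissible-at-peak contractionIndex-at-peak d≡

shrink-factor : ∀ {n t s k v v'} → t < s →
                (∀ j → j ≤ s → N j v ≡ suc (N j v')) → (∀ j → s < j → N j v' ≡ 0) →
                MaxLevelAt n t v → level v t ≡ suc k + (2 + n) →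
                MaxLevelAt n t v' × level v' t ≡ k + (2 + n)
shrink-factor {n} {t} {s} {k} {v} {v'} t<s shrinks vanishes (below , above) levelₜ≡ = (below′ , above′) , levelₜ≡′
  where
  level-shrinks : ∀ j → j ≤ s → level v j ≡ suc (level v' j)
  level-shrinks j j≤s = cong (_+ j) (shrinks j j≤s)
  levelₜ≡′ : level v' t ≡ k + (2 + n)
  levelₜ≡′ = suc-injective (trans (sym (level-shrinks t (<⇒≤ t<s))) levelₜ≡)
  below′ : ∀ j → 1 ≤ j → j ≤ t → level v' j ≤ level v' t
  below′ j 1≤j j≤t = ≤-pred (subst₂ _≤_ (level-shrinks j (≤-trans j≤t (<⇒≤ t<s))) (level-shrinks t (<⇒≤ t<s))
                                        (below j 1≤j j≤t))
  above′ : ∀ j → t < j → j ≤ n → level v' j < level v' t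
  above′ j t<j j≤n with j ≤? s
  ... | yes j≤s = ≤-pred (subst₂ _<_ (level-shrinks j j≤s) (level-shrinks t (<⇒≤ t<s)) (above j t<j j≤n))
  ... | no j≰s = begin-strict
    level v' j      ≡⟨ cong (_+ j) (vanishes j (≰⇒> j≰s)) ⟩
    j               <⟨ s≤s (m≤n⇒m≤1+n j≤n) ⟩
    2 + n           ≤⟨ m≤n+m (2 + n) k ⟩
    k + (2 + n)     ≡⟨ levelₜ≡′ ⟨
    level v' t      ∎
    where open ≤-Reasoning

≤-between⇒∣∣≤ : ∀ {x y z} → x ℤ.≤ z → z ℤ.≤ y → ∣ z ∣ ≤ ∣ x ∣ ⊔ ∣ y ∣
≤-between⇒∣∣≤ {x} {ℤ.+ _}    {ℤ.+ _}     _          (ℤ.+≤+ m≤n) = ≤-trans m≤n (m≤n⊔m ∣ x ∣ _)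
≤-between⇒∣∣≤ { -[1+ _ ]} {y} { -[1+ _ ]} (ℤ.-≤- n≤m) _         = ≤-trans (s≤s n≤m) (m≤m⊔n _ ∣ y ∣)

increasing-ends-bound : ∀ {x mid y} → Increasing (x ∷ mid ∷ʳ y) →
                        All (λ z → ∣ z ∣ ≤ ∣ x ∣ ⊔ ∣ y ∣) (x ∷ mid ∷ʳ y)
increasing-ends-bound {x} {mid} {y} (x<r ∷ r↑) = All.tabulate between
  where
  between : ∀ {z} → z ∈ x ∷ mid ∷ʳ y → ∣ z ∣ ≤ ∣ x ∣ ⊔ ∣ y ∣
  between (here refl) = m≤m⊔n ∣ x ∣ ∣ y ∣
  between (there z∈r) with ∈-++⁻ mid z∈r
  ... | inj₁ z∈mid       =
    ≤-between⇒∣∣≤ (ℤₚ.<⇒≤ (All.lookup x<r z∈r)) (ℤₚ.<⇒≤ (increasing-++-< mid r↑ z∈mid (here refl)))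
  ... | inj₂ (here refl) = m≤n⊔m ∣ x ∣ ∣ y ∣

PairIn⇒ends : ∀ {t v} → 1 ≤ t → PairIn t v → ∃[ x ] ∃[ mid ] ∃[ y ] v ≡ x ∷ mid ∷ʳ y
PairIn⇒ends {v = x ∷ r} _ _ with initLast r
... | mid ∷ʳ′ y = x , mid , y , refl
PairIn⇒ends {v = x ∷ []} 1≤t (here refl , here t≡x) | [] = contradiction (sym t≡x) (-t≢t 1≤t)

level-at-bounded-pair : ∀ {t v} → Increasing v → 1 ≤ t → PairIn t v → All (λ z → ∣ z ∣ ≤ t) v → level v t ≡ 2 + t
level-at-bounded-pair {t} {v} v↑ 1≤t pair bounded =
  trans (level-at-pair v↑ 1≤t pair) (cong (λ m → suc (m + suc t)) (N-none (All.map s≤s bounded)))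

PairIn-∷⁻ : ∀ {t x r} → PairIn t (x ∷ r) → t < ∣ x ∣ → PairIn t r
PairIn-∷⁻ {t} (ī∈ , t∈) t<x = tail ī∈ (∣-t∣≡t t) , tail t∈ refl
  where
  tail : ∀ {z r'} → z ∈ _ ∷ r' → ∣ z ∣ ≡ t → z ∈ r'
  tail (here refl) z≡t = contradiction (sym z≡t) (<⇒≢ t<x)
  tail (there z∈) _ = z∈

PairIn-∷ʳ⁻ : ∀ {t r y} → PairIn t (r ∷ʳ y) → t < ∣ y ∣ → PairIn t r
PairIn-∷ʳ⁻ {t} {r} (ī∈ , t∈) t<y = init ī∈ (∣-t∣≡t t) , init t∈ refl
  where
  init : ∀ {z} → z ∈ r ∷ʳ _ → ∣ z ∣ ≡ t → z ∈ r
  init z∈ z≡t with ∈-++⁻ r z∈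
  ... | inj₁ z∈r         = z∈r
  ... | inj₂ (here refl) = contradiction (sym z≡t) (<⇒≢ t<y)

module _ {n t : ℕ} (1≤t : 1 ≤ t) (t≤n : t ≤ n) where

  private
    pair-below-bound : ∀ {k s v} → Increasing v → PairIn t v → All (λ z → ∣ z ∣ ≤ s) v →
                       level v t ≡ suc k + (2 + n) → t < s
    pair-below-bound {k} {s} v↑ pair bounded levelₜ≡ with t <? s
    ... | yes t<s = t<s
    ... | no t≮s  = contradiction
      (trans (sym levelₜ≡) (level-at-bounded-pair v↑ 1≤t pair (All.map (λ z≤s → ≤-trans z≤s (≮⇒≥ t≮s)) bounded)))
      (>⇒≢ (s≤s (≤-trans (+-monoʳ-≤ 2 t≤n) (m≤n+m (2 + n) k))))

  module _ {k : ℕ} {x y : ℤ} {mid : List ℤ} (v↑ : Increasing (x ∷ mid ∷ʳ y)) (pair : PairIn t (x ∷ mid ∷ʳ y))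
           (v-max : MaxLevelAt n t (x ∷ mid ∷ʳ y)) (levelₜ≡ : level (x ∷ mid ∷ʳ y) t ≡ suc k + (2 + n)) where

    drop-first : ∣ y ∣ ≤ ∣ x ∣ → t < ∣ x ∣ × MaxLevelAt n t (mid ∷ʳ y) × level (mid ∷ʳ y) t ≡ k + (2 + n)
    drop-first y≤x = t<x , shrink-factor {k = k} {v = x ∷ mid ∷ʳ y} {v' = mid ∷ʳ y} t<x shrinks vanishes v-max levelₜ≡
      where
      bound : All (λ z → ∣ z ∣ ≤ ∣ x ∣) (x ∷ mid ∷ʳ y)
      bound = All.map (λ z≤ → ≤-trans z≤ (≤-reflexive (m≥n⇒m⊔n≡m y≤x))) (increasing-ends-bound v↑)
      t<x : t < ∣ x ∣
      t<x = pair-below-bound v↑ pair bound levelₜ≡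
      shrinks : ∀ j → j ≤ ∣ x ∣ → N j (x ∷ mid ∷ʳ y) ≡ suc (N j (mid ∷ʳ y))
      shrinks j = N-accept x (mid ∷ʳ y)
      vanishes : ∀ j → ∣ x ∣ < j → N j (mid ∷ʳ y) ≡ 0
      vanishes j x<j = N-none (All.map (λ z≤x → ≤-<-trans z≤x x<j) (All.tail bound))

    drop-last : ∣ x ∣ < ∣ y ∣ → t < ∣ y ∣ × MaxLevelAt n t (x ∷ mid) × level (x ∷ mid) t ≡ k + (2 + n)
    drop-last x<y = t<y , shrink-factor {k = k} {v = x ∷ mid ∷ʳ y} {v' = x ∷ mid} t<y shrinks vanishes v-max levelₜ≡
      where
      bound : All (λ z → ∣ z ∣ ≤ ∣ y ∣) (x ∷ mid ∷ʳ y)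
      bound = All.map (λ z≤ → ≤-trans z≤ (≤-reflexive (m≤n⇒m⊔n≡n (<⇒≤ x<y)))) (increasing-ends-bound v↑)
      t<y : t < ∣ y ∣
      t<y = pair-below-bound v↑ pair bound levelₜ≡
      shrinks : ∀ j → j ≤ ∣ y ∣ → N j (x ∷ mid ∷ʳ y) ≡ suc (N j (x ∷ mid))
      shrinks j j≤y = trans (N-++ (x ∷ mid) [ y ]) (trans (cong (N j (x ∷ mid) +_) (N-accept y [] j≤y)) (+-comm _ 1))
      vanishes : ∀ j → ∣ y ∣ < j → N j (x ∷ mid) ≡ 0
      vanishes j y<j = N-none (All.map (λ z≤y → ≤-<-trans z≤y y<j) (All.++⁻ˡ (x ∷ mid) bound))

  -- Removing the end letter of larger absolute value lowers the level at t by one and keeps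
  -- it maximal there.
  peel : ∀ {e d} → IsColumn n e → ∀ k u v w → e ≡ u ++ v ++ w → d ≡ u ++ erasePair t v ++ w →
         Increasing v → PairIn t v → MaxLevelAt n t v → level v t ≡ k + (2 + n) → Contraction n e d
  peel e-column zero u v w e≡ d≡ v↑ pair v-max levelₜ≡ =
    contraction-at-peak 1≤t t≤n v↑ pair v-max levelₜ≡ {u = u} {w} e-column e≡ d≡
  peel {e} {d} e-column (suc k) u v w e≡ d≡ v↑ pair v-max levelₜ≡ with PairIn⇒ends 1≤t pair
  ... | x , mid , y , refl with ∣ y ∣ ≤? ∣ x ∣
  ...   | yes y≤x with drop-first v↑ pair v-max levelₜ≡ y≤x
  ...     | t<x , v-max′ , levelₜ≡′ =
    peel e-column k (u ∷ʳ x) (mid ∷ʳ y) w e≡′ d≡′ (AllPairs.tail v↑) (PairIn-∷⁻ pair t<x) v-max′ levelₜ≡′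
    where
    e≡′ : e ≡ (u ∷ʳ x) ++ (mid ∷ʳ y) ++ w
    e≡′ = trans e≡ (sym (++-assoc u [ x ] _))
    d≡′ : d ≡ (u ∷ʳ x) ++ erasePair t (mid ∷ʳ y) ++ w
    d≡′ = trans d≡ (trans (cong (λ c → u ++ c ++ w) (erasePair-keep x (mid ∷ʳ y) (>⇒≢ t<x)))
                          (sym (++-assoc u [ x ] _)))
  peel {e} {d} e-column (suc k) u _ w e≡ d≡ v↑ pair v-max levelₜ≡ | x , mid , y , refl | no y≰x
    with drop-last v↑ pair v-max levelₜ≡ (≰⇒> y≰x)
  ... | t<y , v-max′ , levelₜ≡′ =
    peel e-column k u (x ∷ mid) (y ∷ w) e≡′ d≡′ (increasing-++⁻ˡ (x ∷ mid) v↑) (PairIn-∷ʳ⁻ pair t<y)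
         v-max′ levelₜ≡′
    where
    e≡′ : e ≡ u ++ (x ∷ mid) ++ y ∷ w
    e≡′ = trans e≡ (cong (u ++_) (++-assoc (x ∷ mid) [ y ] w))
    d≡′ : d ≡ u ++ erasePair t (x ∷ mid) ++ y ∷ w
    d≡′ = trans d≡ (cong (u ++_) (begin
      erasePair t (x ∷ mid ∷ʳ y) ++ w                   ≡⟨ cong (_++ w) (erasePair-++ (x ∷ mid) [ y ]) ⟩
      (erasePair t (x ∷ mid) ++ erasePair t [ y ]) ++ w
        ≡⟨ cong (λ c → (erasePair t (x ∷ mid) ++ c) ++ w) (erasePair-keep y [] (>⇒≢ t<y)) ⟩
      (erasePair t (x ∷ mid) ++ [ y ]) ++ w             ≡⟨ ++-assoc (erasePair t (x ∷ mid)) [ y ] w ⟩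
      erasePair t (x ∷ mid) ++ y ∷ w                    ∎))
      where open ≡-Reasoning

below-or-first-reach : ∀ (f : ℕ → ℕ) B J →
  (∀ j → 1 ≤ j → j ≤ J → f j < B) ⊎ ∃[ t ] t < J × (∀ j → 1 ≤ j → j ≤ t → f j < B) × B ≤ f (suc t)
below-or-first-reach f B zero = inj₁ λ { (suc _) _ () }
below-or-first-reach f B (suc J) with below-or-first-reach f B J
... | inj₂ (t , t<J , below , reached) = inj₂ (t , m<n⇒m<1+n t<J , below , reached)
... | inj₁ below with f (suc J) <? B
...   | no fJ≮B  = inj₂ (J , ≤-refl , below , ≮⇒≥ fJ≮B)
...   | yes fJ<B = inj₁ below′
  where
  below′ : ∀ j → 1 ≤ j → j ≤ suc J → f j < B
  below′ j 1≤j j≤J+1 with m≤n⇒m<n∨m≡n j≤J+1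
  ... | inj₁ j<J+1 = below j 1≤j (≤-pred j<J+1)
  ... | inj₂ refl  = fJ<B

module _ {n t : ℕ} {d : List ℤ} (d-column : IsColumn n d) (1≤t : 1 ≤ t) (t≤n : t ≤ n)
         (below : ∀ j → 1 ≤ j → j ≤ t → level d j < peak n d) (reached : peak n d ≤ level d (suc t)) where

  private
    letters : All (IsLetter n) d
    letters = proj₂ d-column

    P : ℕ
    P = peak n d

    level-next≡ : level d (suc t) ≡ P
    level-next≡ = ≤-antisym (level≤peak-letters d letters (s≤s z≤n) (s≤s t≤n)) reached

    t-absent : countAbs t d ≡ 0
    t-absent = n≤0⇒n≡0 (+-cancelʳ-≤ P (countAbs t d) 0 (begin
      countAbs t d + P               ≡⟨ cong (countAbs t d +_) level-next≡ ⟨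
      countAbs t d + level d (suc t) ≡⟨ level-suc t d ⟨
      suc (level d t)                ≤⟨ below t 1≤t ≤-refl ⟩
      P                              ∎))
      where open ≤-Reasoning

    level≡ : suc (level d t) ≡ P
    level≡ = trans (level-suc t d) (trans (cong (_+ level d (suc t)) t-absent) level-next≡)

    e : List ℤ
    e = withPair t d

    e-max : MaxLevelAt n t e
    e-max = below′ , above′
      where
      below′ : ∀ j → 1 ≤ j → j ≤ t → level e j ≤ level e t
      below′ j 1≤j j≤t = subst₂ _≤_ (sym (level-withPair-≤ {t} {d} j j≤t)) (sym (level-withPair-≤ {t} {d} t ≤-refl))
        (+-monoʳ-≤ 2 (≤-pred (subst (level d j <_) (sym level≡) (below j 1≤j j≤t))))
      above′ : ∀ j → t < j → j ≤ n → level e j < level e t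
      above′ j t<j j≤n = subst₂ _<_ (sym (level-withPair-> {t} {d} j t<j)) (sym (level-withPair-≤ {t} {d} t ≤-refl))
        (s≤s (subst (level d j ≤_) (sym level≡) (level≤peak d (≤-trans (s≤s z≤n) t<j) j≤n)))

    levelₜ≡ : level e t ≡ (P ∸ suc n) + (2 + n)
    levelₜ≡ = begin
      level e t                      ≡⟨ level-withPair-≤ {t} {d} t ≤-refl ⟩
      suc (suc (level d t))          ≡⟨ cong suc level≡ ⟩
      suc P                          ≡⟨ cong suc (m∸n+n≡m (suc≤peak d)) ⟨
      suc (P ∸ suc n + suc n)        ≡⟨ +-suc (P ∸ suc n) (suc n) ⟨
      (P ∸ suc n) + (2 + n)          ∎
      where open ≡-Reasoning

  withPair-contraction : Contraction n (withPair t d) d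
  withPair-contraction = peel 1≤t t≤n (withPair-column absent 1≤t t≤n d-column) (P ∸ suc n) [] e []
    (sym (++-identityʳ e)) (sym (trans (++-identityʳ _) (erasePair-withPair absent)))
    (Linked⇒AllPairs ℤₚ.<-trans (proj₁ (withPair-column absent 1≤t t≤n d-column))) (PairIn-withPair {t} {d}) e-max levelₜ≡
    where
    absent : All (λ x → ∣ x ∣ ≢ t) d
    absent = countAbs≡0 d t-absent

peak-undilatable : ∀ {n d} → IsColumn n d → (∀ e → ¬ Contraction n e d) → peak n d ≡ suc (length d)
peak-undilatable {n} {d} d-column@(_ , letters) undilatable with level d 1 <? peak n d
... | no level₁≮peak =
  trans (≤-antisym (≮⇒≥ level₁≮peak) (level≤peak-letters d letters ≤-refl (s≤s z≤n))) (level-one d letters)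
... | yes level₁<peak with peak-attained-letters d letters
... | J , 1≤J , J≤n+1 , level≡peak with below-or-first-reach (level d) (peak n d) J
...   | inj₁ below = contradiction level≡peak (<⇒≢ (below J 1≤J ≤-refl))
...   | inj₂ (zero , _ , _ , reached) = contradiction reached (<⇒≱ level₁<peak)
...   | inj₂ (suc t , t<J , below , reached) =
  ⊥-elim (undilatable _ (withPair-contraction d-column (s≤s z≤n) (≤-pred (≤-trans t<J J≤n+1)) below reached))

-- Chains of contractions

peak-contractions : ∀ {n k c c'} → Contractions n k c c' → peak n c ≡ k + peak n c'
peak-contractions done            = refl
peak-contractions (step c⇝ c⇝⋆) = trans (peak-contraction c⇝) (cong suc (peak-contractions c⇝⋆))

peak-contracted-to-admissible : ∀ {n k c a} → Contractions n k c a → Admissible n a → peak n c ≡ k + suc n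
peak-contracted-to-admissible {k = k} {a = a} c⇝a a-adm = trans (peak-contractions c⇝a) (cong (k +_) (peak-admissible a a-adm))

length-contractions : ∀ {n k c c'} → Contractions n k c c' → length c ≡ (k + k) + length c'
length-contractions done = refl
length-contractions {k = suc k} {c} {c'} (step {c' = c₁} c⇝ c⇝⋆) = begin
  length c                     ≡⟨ length-contraction c⇝ ⟩
  2 + length c₁                ≡⟨ cong (2 +_) (length-contractions c⇝⋆) ⟩
  2 + (k + k + length c')      ≡⟨ cong (λ m → suc m + length c') (+-suc k k) ⟨
  suc k + suc k + length c'    ∎
  where open ≡-Reasoning

contractions-source-column : ∀ {n k d c} → Contractions n k d c → IsColumn n c → IsColumn n d
contractions-source-column done                                        c-column = c-column
contractions-source-column (step (contract _ _ _ _ d-column _ _ _ _) _) _        = d-column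

peak-maximal-dilatation : ∀ {n k d c} → Contractions n k d c → IsColumn n c → (∀ e → ¬ Contraction n e d) →
                          peak n d ≡ k + (k + suc (length c))
peak-maximal-dilatation {n} {k} {d} {c} d⇝c c-column undilatable = begin
  peak n d                      ≡⟨ peak-undilatable (contractions-source-column d⇝c c-column) undilatable ⟩
  suc (length d)                ≡⟨ cong suc (length-contractions d⇝c) ⟩
  suc (k + k + length c)        ≡⟨ rearrange k (length c) ⟩
  k + (k + suc (length c))      ∎
  where
  open ≡-Reasoning
  rearrange : ∀ m l → suc (m + m + l) ≡ m + (m + suc l)
  rearrange = solve-∀

mainTheorem2 : (n : ℕ) → 1 ≤ n →
    (cj : List ℤ) → IsColumn n cj → length cj ≡ n →
    (dj : List ℤ) → MaximalDilatation n cj dj →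
    (δj : ℕ) (a : List ℤ) → Contractions n δj dj a → Admissible n a →
    (k : ℕ) (e : List ℤ) → Contractions n k cj e → Admissible n e →
    (δj + length e ≡ n) × (2 ∣ δj)
mainTheorem2 n _ cj cj-column length-cj dj ((k′ , dj⇝cj) , undilatable) δ a dj⇝a a-adm k e cj⇝e e-adm =
  δ+length-e≡n , divides k′ (trans δ≡k′+k′ (double k′))
  where
  open ≡-Reasoning
  peak-dj : peak n dj ≡ k′ + (k′ + suc n)
  peak-dj = trans (peak-maximal-dilatation dj⇝cj cj-column undilatable) (cong (λ m → k′ + (k′ + suc m)) length-cj)

  δ≡k′+k′ : δ ≡ k′ + k′
  δ≡k′+k′ = +-cancelʳ-≡ (suc n) δ (k′ + k′)
    (trans (sym (peak-contracted-to-admissible dj⇝a a-adm)) (trans peak-dj (sym (+-assoc k′ k′ (suc n)))))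

  k≡k′ : k ≡ k′
  k≡k′ = +-cancelʳ-≡ (suc n) k k′ (+-cancelˡ-≡ k′ _ _ (begin
    k′ + (k + suc n)       ≡⟨ cong (k′ +_) (peak-contracted-to-admissible cj⇝e e-adm) ⟨
    k′ + peak n cj         ≡⟨ peak-contractions dj⇝cj ⟨
    peak n dj              ≡⟨ peak-dj ⟩
    k′ + (k′ + suc n)      ∎))

  δ+length-e≡n : δ + length e ≡ n
  δ+length-e≡n = begin
    δ + length e           ≡⟨ cong (_+ length e) (trans δ≡k′+k′ (sym (cong₂ _+_ k≡k′ k≡k′))) ⟩
    (k + k) + length e     ≡⟨ length-contractions cj⇝e ⟨
    length cj              ≡⟨ length-cj ⟩
    n                      ∎

  double : ∀ m → m + m ≡ m ℕ.* 2
  double = solve-∀
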